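{- Let $G$ be a graph, $S\subseteq V(G)$ with $|S|=s$, and $\ell\leq s$ a natural number. If for all $1\leq k\leq s$ $$\sum_{W\in\binom{S}{k}}|\mathrm{Obs}(G;W)|=\sum_{i=1}^{\ell}\alpha_{s,\ell}(k,i)\sum_{W\in\binom{S}{i}}|\mathrm{Obs}(G;W)|,$$ then $\mathcal{E}(G;S,q)$ has degree at most $\ell$.
   Context: Graphs are finite and simple; $N[X]$ is the closed neighborhood of $X$. Power domination process on a graph $H$ from $T\subseteq V(H)$: set $B:=N[T]$; then, while some $x\in B$ has exactly one vertex $y$ of $N[x]$ outside $B$, add $y$ to $B$. The final set is $\mathrm{Obs}(H;T)$ (with $\mathrm{Obs}(H;\emptyset)=\emptyset$). For $S\subseteq V(H)$, $\mathcal{E}(H;S,q)=\sum_{W\subseteq S}|\mathrm{Obs}(H;W)|\,q^{|S\setminus W|}(1-q)^{|W|}$. $\binom{S}{k}$ is the set of $k$-element subsets of $S$. The numbers $\alpha_{s,\ell}(k,i)$ are defined recursively by $\alpha_{s,\ell}(k,i):=\binom{s-i}{k-i}-\sum_{j=i+1}^{\ell}\alpha_{s,\ell}(k,j)\binom{s-i}{j-i}$ (empty sum $=0$; binomial coefficients with lower index negative or exceeding the upper index are $0$). -}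

module Defs where

open import Data.Bool using (Bool; true; false; _∧_; _∨_; not; if_then_else_)
open import Data.Nat as ℕ using (ℕ; zero; suc; _∸_; _≤_; _<_; _<ᵇ_; _≡ᵇ_)
open import Data.Nat.Combinatorics using (_C_)
open import Data.Integer as ℤ using (ℤ)
open import Data.Fin using (Fin; _≟_)
open import Data.Fin.Subset using (Subset; inside; outside; _⊆_; _∪_; _─_; ∣_∣)
open import Data.Fin.Subset.Properties using (_⊆?_)
open import Data.List as List using (List; []; _∷_; _++_; map; filter; foldr; applyUpTo; findᵇ; allFin)
open import Data.Bool.ListAction using (any)
open import Data.Maybe using (Maybe; just; nothing)
open import Data.Vec using (Vec; []; _∷_; tabulate; lookup)
open import Relation.Nullary.Decidable using (⌊_⌋)
open import Relation.Binary.PropositionalEquality using (_≡_)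

record Graph (n : ℕ) : Set where
  field
    adj    : Fin n → Fin n → Bool
    sym    : ∀ x y → adj x y ≡ adj y x
    irrefl : ∀ x → adj x x ≡ false
open Graph public

N[_∣_] : ∀ {n} → Graph n → Fin n → Subset n
N[ G ∣ x ] = tabulate (λ y → ⌊ y ≟ x ⌋ ∨ adj G x y)

NS[_∣_] : ∀ {n} → Graph n → Subset n → Subset n
NS[_∣_] {n} G T = tabulate (λ y → any (λ x → lookup T x ∧ lookup N[ G ∣ x ] y) (allFin n))

forces : ∀ {n} → Graph n → Subset n → Fin n → Bool
forces G B x = lookup B x ∧ (∣ N[ G ∣ x ] ─ B ∣ ≡ᵇ 1)

step : ∀ {n} → Graph n → Subset n → Subset n
step {n} G B with findᵇ (forces G B) (allFin n)
... | just x  = B ∪ (N[ G ∣ x ] ─ B)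
... | nothing = B

iter : ∀ {A : Set} → ℕ → (A → A) → A → A
iter zero    f a = a
iter (suc k) f a = iter k f (f a)

-- each effective step adds a vertex, so after n steps the process is finished
Obs : ∀ {n} → Graph n → Subset n → Subset n
Obs {n} G T = iter n (step G) NS[ G ∣ T ]

allSubsets : ∀ n → List (Subset n)
allSubsets zero    = [] ∷ []
allSubsets (suc n) = map (outside ∷_) (allSubsets n) ++ map (inside ∷_) (allSubsets n)

subsetsOf : ∀ {n} → Subset n → List (Subset n)
subsetsOf {n} S = filter (λ W → W ⊆? S) (allSubsets n)

choose : ∀ {n} → Subset n → ℕ → List (Subset n)
choose S k = filter (λ W → ∣ W ∣ ℕ.≟ k) (subsetsOf S)

sumℤ : List ℤ → ℤ
sumℤ = foldr ℤ._+_ ℤ.0ℤ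

obsSum : ∀ {n} → Graph n → Subset n → ℕ → ℤ
obsSum G S k = sumℤ (map (λ W → ℤ.+ ∣ Obs G W ∣) (choose S k))

-- binomial coefficient  binom(a - i, b - i)  with the convention that it is 0
-- when the lower index b - i is negative (i.e. b < i) or exceeds the upper one
binomShift : ℕ → ℕ → ℕ → ℤ
binomShift a b i = if b <ᵇ i then ℤ.0ℤ else ℤ.+ ((a ∸ i) C (b ∸ i))

range : ℕ → ℕ → List ℕ
range a b = applyUpTo (λ t → a ℕ.+ t) (suc b ∸ a)

-- fuel-driven version of the recursion (fuel ≥ ℓ ∸ i suffices)
alphaF : ℕ → (s ℓ k i : ℕ) → ℤ
alphaF zero    s ℓ k i = binomShift s k i
alphaF (suc f) s ℓ k i =
  binomShift s k i ℤ.- sumℤ (map (λ j → alphaF f s ℓ k j ℤ.* binomShift s j i) (range (suc i) ℓ))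

alpha : (s ℓ k i : ℕ) → ℤ
alpha s ℓ k i = alphaF (ℓ ∸ i) s ℓ k i

-- Polynomials over ℤ in one variable q, as coefficient lists (constant first)

Poly : Set
Poly = List ℤ

_+P_ : Poly → Poly → Poly
[]       +P ys       = ys
(x ∷ xs) +P []       = x ∷ xs
(x ∷ xs) +P (y ∷ ys) = (x ℤ.+ y) ∷ (xs +P ys)

scaleP : ℤ → Poly → Poly
scaleP c = map (c ℤ.*_)

_*P_ : Poly → Poly → Poly
[]       *P ys = []
(x ∷ xs) *P ys = scaleP x ys +P (ℤ.0ℤ ∷ (xs *P ys))

_^P_ : Poly → ℕ → Poly
p ^P zero  = ℤ.1ℤ ∷ []
p ^P suc k = p *P (p ^P k)

varQ : Poly
varQ = ℤ.0ℤ ∷ ℤ.1ℤ ∷ []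

oneMinusQ : Poly
oneMinusQ = ℤ.1ℤ ∷ ℤ.-1ℤ ∷ []

coeff : Poly → ℕ → ℤ
coeff []       _       = ℤ.0ℤ
coeff (x ∷ xs) zero    = x
coeff (x ∷ xs) (suc d) = coeff xs d

DegreeAtMost : Poly → ℕ → Set
DegreeAtMost p ℓ = ∀ d → ℓ < d → coeff p d ≡ ℤ.0ℤ

Epoly : ∀ {n} → Graph n → Subset n → Poly
Epoly G S = foldr _+P_ []
  (map (λ W → scaleP (ℤ.+ ∣ Obs G W ∣) ((varQ ^P ∣ S ─ W ∣) *P (oneMinusQ ^P ∣ W ∣)))
       (subsetsOf S))

{-# OPTIONS --safe #-}
module Submission where

-- Put c_k = q^(s-k) (1-q)^k and a_k = Σ_{|W| = k} |Obs(G;W)|, so that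
-- E = Σ_k a_k c_k with a_0 = 0. Substituting the hypothesis gives E = Σ_{i=1}^ℓ a_i X_i
-- with X_i = Σ_k α(k,i) c_k. The recursion defining α says exactly that
-- X_i + Σ_{i<j≤ℓ} C(s-i,j-i) X_j = Σ_k C(s-i,k-i) c_k = (1-q)^i (q + (1-q))^(s-i) = (1-q)^i,
-- which has degree i ≤ ℓ. So in each degree d > ℓ the coefficients of X_1, …, X_ℓ solve a
-- homogeneous unitriangular system; hence they vanish, and with them the coefficient of E.

open import Defs
open import Data.Nat using (ℕ; _≤_)
open import Data.Fin.Subset using (Subset; ∣_∣)
open import Data.List using (map)
open import Data.Integer using (_*_)
open import Relation.Binary.PropositionalEquality using (_≡_)

open import Data.Bool using (Bool; true; false; _∧_; if_then_else_)
open import Data.Bool.ListAction using (any)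
open import Data.Fin using (toℕ)
open import Data.Fin.Properties using (toℕ<n; toℕ-inject₁; toℕ-fromℕ)
open import Data.Fin.Subset using (inside; outside; _⊆_; _─_; ⊥)
open import Data.Fin.Subset.Properties using (drop-∷-⊆; p⊆q⇒∣p∣≤∣q∣; ∣⊥∣≡0; _⊆?_)
open import Data.Integer as ℤ using (ℤ; _+_; _-_; 0ℤ; 1ℤ; -1ℤ)
import Data.Integer.Properties as ℤP
open import Data.Integer.Tactic.RingSolver using (solve-∀)
open import Data.List using ([]; _∷_; foldr; applyUpTo; filter; findᵇ; allFin)
open import Data.List.Properties using (map-cong-local)
open import Data.List.Relation.Unary.All as All using (All; []; _∷_)
open import Data.List.Relation.Unary.All.Properties using (all-filter)
open import Data.Maybe using (nothing)
open import Data.Nat as ℕ using (zero; suc; _∸_; _<_; z≤n; s≤s)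
open import Data.Nat.Combinatorics using (_C_; nCk+nC[k+1]≡[n+1]C[k+1]; k>n⇒nCk≡0)
import Data.Nat.Properties as ℕP
open import Data.Vec using ([]; _∷_; lookup; here)
open import Data.Vec.Properties using (lookup-replicate; tabulate-cong; tabulate∘lookup)
import Relation.Binary.PropositionalEquality as ≡
open import Relation.Binary.PropositionalEquality
  using (refl; trans; cong; cong₂; subst; _≗_; module ≡-Reasoning)
open import Relation.Nullary using (does; contradiction)

open import Algebra.Properties.AbelianGroup ℤP.+-0-abelianGroup using (∙-cancelʳ)
open import Algebra.Properties.Semiring.Sum ℤP.+-*-semiring
  using (sum; sum-cong-≗; sum-replicate-zero; sum-init-last; ∑-distrib-+; ∑-comm; *-distribˡ-sum; *-distribʳ-sum)

open ≡-Reasoning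

Σ< : ℕ → (ℕ → ℤ) → ℤ
Σ< n f = sum {n} (λ i → f (toℕ i))

infix 6.5 Σ<
syntax Σ< n (λ k → e) = Σ[ k < n ] e

Σ-cong : ∀ n {f g : ℕ → ℤ} → (∀ k → k < n → f k ≡ g k) → Σ< n f ≡ Σ< n g
Σ-cong n f≡g = sum-cong-≗ (λ i → f≡g (toℕ i) (toℕ<n i))

Σ-zero : ∀ n {f : ℕ → ℤ} → (∀ k → k < n → f k ≡ 0ℤ) → Σ< n f ≡ 0ℤ
Σ-zero n f≡0 = trans (Σ-cong n f≡0) (sum-replicate-zero n)

Σ-last : ∀ n (f : ℕ → ℤ) → Σ< (suc n) f ≡ Σ< n f + f n
Σ-last n f = trans (sum-init-last {n} (λ i → f (toℕ i)))
  (cong₂ _+_ (sum-cong-≗ {n} (λ i → cong f (toℕ-inject₁ i))) (cong f (toℕ-fromℕ n)))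

Σ-+ : ∀ n (f g : ℕ → ℤ) → Σ[ k < n ] (f k + g k) ≡ Σ< n f + Σ< n g
Σ-+ n f g = ∑-distrib-+ {n} (λ i → f (toℕ i)) (λ i → g (toℕ i))

Σ-comm : ∀ m n (F : ℕ → ℕ → ℤ) → Σ[ k < m ] Σ< n (F k) ≡ Σ[ t < n ] Σ[ k < m ] F k t
Σ-comm m n F = ∑-comm {m} {n} (λ i j → F (toℕ i) (toℕ j))

*-distribˡ-Σ : ∀ n x (f : ℕ → ℤ) → x * Σ< n f ≡ Σ[ k < n ] x * f k
*-distribˡ-Σ n x f = *-distribˡ-sum {n} x (λ i → f (toℕ i))

*-distribʳ-Σ : ∀ n x (f : ℕ → ℤ) → Σ< n f * x ≡ Σ[ k < n ] f k * x
*-distribʳ-Σ n x f = *-distribʳ-sum {n} x (λ i → f (toℕ i))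

Σ-exchange : ∀ m n (α : ℕ → ℕ → ℤ) (u c : ℕ → ℤ) →
  Σ[ k < m ] (Σ[ t < n ] α k t * u t) * c k ≡ Σ[ t < n ] u t * (Σ[ k < m ] α k t * c k)
Σ-exchange m n α u c = begin
    Σ[ k < m ] (Σ[ t < n ] α k t * u t) * c k
  ≡⟨ Σ-cong m (λ k _ → *-distribʳ-Σ n (c k) (λ t → α k t * u t)) ⟩
    Σ[ k < m ] (Σ[ t < n ] (α k t * u t) * c k)
  ≡⟨ Σ-comm m n (λ k t → (α k t * u t) * c k) ⟩
    Σ[ t < n ] (Σ[ k < m ] (α k t * u t) * c k)
  ≡⟨ Σ-cong n (λ t _ → Σ-cong m (λ k _ → reassoc (α k t) (u t) (c k))) ⟩
    Σ[ t < n ] (Σ[ k < m ] u t * (α k t * c k))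
  ≡⟨ Σ-cong n (λ t _ → ≡.sym (*-distribˡ-Σ m (u t) (λ k → α k t * c k))) ⟩
    Σ[ t < n ] u t * (Σ[ k < m ] α k t * c k)
  ∎
  where
    reassoc : ∀ x y z → (x * y) * z ≡ y * (x * z)
    reassoc = solve-∀

Σ-indicator : ∀ n i (y : ℤ) (c : ℕ → ℤ) → i < n →
  Σ[ k < n ] (if does (i ℕ.≟ k) then y else 0ℤ) * c k ≡ y * c i
Σ-indicator (suc n) zero    y c _         = trans (cong (y * c 0 +_) (sum-replicate-zero n)) (ℤP.+-identityʳ _)
Σ-indicator (suc n) (suc i) y c (s≤s i<n) = trans (ℤP.+-identityˡ _) (Σ-indicator n i y (λ k → c (suc k)) i<n)

sumℤ-applyUpTo : ∀ {A : Set} n (g : A → ℤ) (f : ℕ → A) → sumℤ (map g (applyUpTo f n)) ≡ Σ[ t < n ] g (f t)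
sumℤ-applyUpTo zero    g f = refl
sumℤ-applyUpTo (suc n) g f = cong (g (f 0) +_) (sumℤ-applyUpTo n g (λ t → f (suc t)))

sumℤ-zero : ∀ {A : Set} {f : A → ℤ} {xs} → All (λ x → f x ≡ 0ℤ) xs → sumℤ (map f xs) ≡ 0ℤ
sumℤ-zero []             = refl
sumℤ-zero (fx≡0 ∷ fxs≡0) = cong₂ _+_ fx≡0 (sumℤ-zero fxs≡0)

sumℤ-filter-∷ : ∀ {A : Set} (κ : A → ℕ) (f : A → ℤ) k x xs →
  sumℤ (map f (filter (λ y → κ y ℕ.≟ k) (x ∷ xs)))
    ≡ (if does (κ x ℕ.≟ k) then f x else 0ℤ) + sumℤ (map f (filter (λ y → κ y ℕ.≟ k) xs))
sumℤ-filter-∷ κ f k x xs with does (κ x ℕ.≟ k)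
... | true  = refl
... | false = ≡.sym (ℤP.+-identityˡ _)

sumℤ-groupBy : ∀ {A : Set} n (κ : A → ℕ) (f : A → ℤ) (c : ℕ → ℤ) xs → All (λ x → κ x < n) xs →
  sumℤ (map (λ x → f x * c (κ x)) xs) ≡ Σ[ k < n ] sumℤ (map f (filter (λ x → κ x ℕ.≟ k) xs)) * c k
sumℤ-groupBy n κ f c []       []              = ≡.sym (sum-replicate-zero n)
sumℤ-groupBy n κ f c (x ∷ xs) (κx<n ∷ κxs<n) = begin
    f x * c (κ x) + sumℤ (map (λ x → f x * c (κ x)) xs)
  ≡⟨ cong₂ _+_ (≡.sym (Σ-indicator n (κ x) (f x) c κx<n)) (sumℤ-groupBy n κ f c xs κxs<n) ⟩
    Σ[ k < n ] indicator k * c k + Σ[ k < n ] rest k * c k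
  ≡⟨ ≡.sym (Σ-+ n (λ k → indicator k * c k) (λ k → rest k * c k)) ⟩
    Σ[ k < n ] (indicator k * c k + rest k * c k)
  ≡⟨ Σ-cong n (λ k _ → ≡.sym (ℤP.*-distribʳ-+ (c k) (indicator k) (rest k))) ⟩
    Σ[ k < n ] (indicator k + rest k) * c k
  ≡⟨ Σ-cong n (λ k _ → cong (_* c k) (≡.sym (sumℤ-filter-∷ κ f k x xs))) ⟩
    Σ[ k < n ] sumℤ (map f (filter (λ x → κ x ℕ.≟ k) (x ∷ xs))) * c k
  ∎
  where
    indicator rest : ℕ → ℤ
    indicator k = if does (κ x ℕ.≟ k) then f x else 0ℤ
    rest k = sumℤ (map f (filter (λ x → κ x ℕ.≟ k) xs))

-- Polynomials are handled through their coefficient functions ℕ → ℤ (coefficient lists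
-- differing by trailing zeros are different lists); on these, q· and q^ a · act as
-- multiplication by q and q^a, and _⊛_ is the product.

coeff-+P : ∀ p r d → coeff (p +P r) d ≡ coeff p d + coeff r d
coeff-+P []      r       d       = ≡.sym (ℤP.+-identityˡ _)
coeff-+P (x ∷ p) []      d       = ≡.sym (ℤP.+-identityʳ _)
coeff-+P (x ∷ p) (y ∷ r) zero    = refl
coeff-+P (x ∷ p) (y ∷ r) (suc d) = coeff-+P p r d

coeff-scaleP : ∀ c p d → coeff (scaleP c p) d ≡ c * coeff p d
coeff-scaleP c []      d       = ≡.sym (ℤP.*-zeroʳ c)
coeff-scaleP c (x ∷ p) zero    = refl
coeff-scaleP c (x ∷ p) (suc d) = coeff-scaleP c p d

coeff-foldr-+P : ∀ {A : Set} (F : A → Poly) xs d →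
  coeff (foldr _+P_ [] (map F xs)) d ≡ sumℤ (map (λ x → coeff (F x) d) xs)
coeff-foldr-+P F []       d = refl
coeff-foldr-+P F (x ∷ xs) d = trans (coeff-+P (F x) _ d) (cong (coeff (F x) d +_) (coeff-foldr-+P F xs d))

q·_ : (ℕ → ℤ) → ℕ → ℤ
(q· f) zero    = 0ℤ
(q· f) (suc d) = f d

q^_·_ : ℕ → (ℕ → ℤ) → ℕ → ℤ
q^ zero  · f = f
q^ suc a · f = q· (q^ a · f)

q·-cong : ∀ {f g} → f ≗ g → q· f ≗ q· g
q·-cong f≗g zero    = refl
q·-cong f≗g (suc d) = f≗g d

q^-cong : ∀ a {f g} → f ≗ g → q^ a · f ≗ q^ a · g
q^-cong zero    f≗g = f≗g
q^-cong (suc a) f≗g = q·-cong (q^-cong a f≗g)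

q^-q· : ∀ a f → q^ a · (q· f) ≗ q· (q^ a · f)
q^-q· zero    f d = refl
q^-q· (suc a) f   = q·-cong (q^-q· a f)

q^-+ : ∀ a {f g h : ℕ → ℤ} → (∀ d → f d + g d ≡ h d) → ∀ d → (q^ a · f) d + (q^ a · g) d ≡ (q^ a · h) d
q^-+ zero    f+g≡h d       = f+g≡h d
q^-+ (suc a) f+g≡h zero    = refl
q^-+ (suc a) f+g≡h (suc d) = q^-+ a f+g≡h d

Σ-q· : ∀ n (b : ℕ → ℤ) (g : ℕ → ℕ → ℤ) d →
  Σ[ k < n ] b k * (q· g k) d ≡ (q· (λ x → Σ[ k < n ] b k * g k x)) d
Σ-q· n b g zero    = Σ-zero n (λ k _ → ℤP.*-zeroʳ (b k))
Σ-q· n b g (suc d) = refl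

coeff-0∷ : ∀ p → coeff (0ℤ ∷ p) ≗ q· coeff p
coeff-0∷ p zero    = refl
coeff-0∷ p (suc d) = refl

_⊛_ : (ℕ → ℤ) → (ℕ → ℤ) → ℕ → ℤ
(f ⊛ g) zero    = f 0 * g 0
(f ⊛ g) (suc d) = f 0 * g (suc d) + ((λ i → f (suc i)) ⊛ g) d

⊛-head : ∀ f g d → (f ⊛ g) d ≡ f 0 * g d + (q· ((λ i → f (suc i)) ⊛ g)) d
⊛-head f g zero    = ≡.sym (ℤP.+-identityʳ _)
⊛-head f g (suc d) = refl

⊛-zeroˡ : ∀ g → (λ _ → 0ℤ) ⊛ g ≗ λ _ → 0ℤ
⊛-zeroˡ g zero    = refl
⊛-zeroˡ g (suc d) = cong (0ℤ +_) (⊛-zeroˡ g d)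

⊛-congˡ : ∀ {f f′} g → f ≗ f′ → f ⊛ g ≗ f′ ⊛ g
⊛-congˡ g f≗f′ zero    = cong (_* g 0) (f≗f′ 0)
⊛-congˡ g f≗f′ (suc d) = cong₂ _+_ (cong (_* g (suc d)) (f≗f′ 0)) (⊛-congˡ g (λ i → f≗f′ (suc i)) d)

⊛-constˡ : ∀ c g → coeff (c ∷ []) ⊛ g ≗ λ d → c * g d
⊛-constˡ c g zero    = refl
⊛-constˡ c g (suc d) = trans (cong (c * g (suc d) +_) (⊛-zeroˡ g d)) (ℤP.+-identityʳ _)

⊛-identityˡ : ∀ g → coeff (1ℤ ∷ []) ⊛ g ≗ g
⊛-identityˡ g d = trans (⊛-constˡ 1ℤ g d) (ℤP.*-identityˡ (g d))

⊛-q^ˡ : ∀ a f g → (q^ a · f) ⊛ g ≗ q^ a · (f ⊛ g)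
⊛-q^ˡ zero    f g d = refl
⊛-q^ˡ (suc a) f g d = trans (⊛-head (q^ suc a · f) g d)
  (trans (ℤP.+-identityˡ _) (q·-cong (⊛-q^ˡ a f g) d))

coeff-*P : ∀ p r → coeff (p *P r) ≗ coeff p ⊛ coeff r
coeff-*P []      r d = ≡.sym (⊛-zeroˡ (coeff r) d)
coeff-*P (x ∷ p) r d = begin
    coeff (scaleP x r +P (0ℤ ∷ (p *P r))) d
  ≡⟨ coeff-+P (scaleP x r) _ d ⟩
    coeff (scaleP x r) d + coeff (0ℤ ∷ (p *P r)) d
  ≡⟨ cong₂ _+_ (coeff-scaleP x r d) (trans (coeff-0∷ (p *P r) d) (q·-cong (coeff-*P p r) d)) ⟩
    x * coeff r d + (q· (coeff p ⊛ coeff r)) d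
  ≡⟨ ≡.sym (⊛-head (coeff (x ∷ p)) (coeff r) d) ⟩
    (coeff (x ∷ p) ⊛ coeff r) d
  ∎

coeff-varQ^P : ∀ a → coeff (varQ ^P a) ≗ q^ a · coeff (1ℤ ∷ [])
coeff-varQ^P zero    d = refl
coeff-varQ^P (suc a) d = begin
    coeff (varQ *P (varQ ^P a)) d
  ≡⟨ coeff-*P varQ (varQ ^P a) d ⟩
    (coeff varQ ⊛ coeff (varQ ^P a)) d
  ≡⟨ ⊛-congˡ _ (coeff-0∷ (1ℤ ∷ [])) d ⟩
    ((q^ 1 · coeff (1ℤ ∷ [])) ⊛ coeff (varQ ^P a)) d
  ≡⟨ ⊛-q^ˡ 1 _ _ d ⟩
    (q· (coeff (1ℤ ∷ []) ⊛ coeff (varQ ^P a))) d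
  ≡⟨ q·-cong (λ x → trans (⊛-identityˡ _ x) (coeff-varQ^P a x)) d ⟩
    (q^ suc a · coeff (1ℤ ∷ [])) d
  ∎

coeff-varQ^P*P : ∀ a p → coeff ((varQ ^P a) *P p) ≗ q^ a · coeff p
coeff-varQ^P*P a p d = begin
    coeff ((varQ ^P a) *P p) d
  ≡⟨ coeff-*P (varQ ^P a) p d ⟩
    (coeff (varQ ^P a) ⊛ coeff p) d
  ≡⟨ ⊛-congˡ (coeff p) (coeff-varQ^P a) d ⟩
    ((q^ a · coeff (1ℤ ∷ [])) ⊛ coeff p) d
  ≡⟨ ⊛-q^ˡ a _ _ d ⟩
    (q^ a · (coeff (1ℤ ∷ []) ⊛ coeff p)) d
  ≡⟨ q^-cong a (⊛-identityˡ (coeff p)) d ⟩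
    (q^ a · coeff p) d
  ∎

coeff-oneMinusQ*P : ∀ p d → coeff (oneMinusQ *P p) d + (q· coeff p) d ≡ coeff p d
coeff-oneMinusQ*P p zero = begin
    coeff (oneMinusQ *P p) 0 + 0ℤ  ≡⟨ ℤP.+-identityʳ _ ⟩
    coeff (oneMinusQ *P p) 0       ≡⟨ coeff-*P oneMinusQ p 0 ⟩
    1ℤ * coeff p 0                 ≡⟨ ℤP.*-identityˡ _ ⟩
    coeff p 0                      ∎
coeff-oneMinusQ*P p (suc d) = begin
    coeff (oneMinusQ *P p) (suc d) + coeff p d
  ≡⟨ cong (_+ coeff p d) (coeff-*P oneMinusQ p (suc d)) ⟩
    (1ℤ * coeff p (suc d) + (coeff (-1ℤ ∷ []) ⊛ coeff p) d) + coeff p d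
  ≡⟨ cong (λ z → (1ℤ * coeff p (suc d) + z) + coeff p d) (⊛-constˡ -1ℤ (coeff p) d) ⟩
    (1ℤ * coeff p (suc d) + -1ℤ * coeff p d) + coeff p d
  ≡⟨ cancel (coeff p (suc d)) (coeff p d) ⟩
    coeff p (suc d)
  ∎
  where
    cancel : ∀ x y → (1ℤ * x + -1ℤ * y) + y ≡ x
    cancel = solve-∀

oneMinusQ^P-degree : ∀ k → DegreeAtMost (oneMinusQ ^P k) k
oneMinusQ^P-degree zero    (suc d) _         = refl
oneMinusQ^P-degree (suc k) (suc d) (s≤s k<d) = begin
    coeff (oneMinusQ ^P suc k) (suc d)
  ≡⟨ ≡.sym (ℤP.+-identityʳ _) ⟩
    coeff (oneMinusQ ^P suc k) (suc d) + 0ℤ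
  ≡⟨ cong (coeff (oneMinusQ ^P suc k) (suc d) +_) (≡.sym (oneMinusQ^P-degree k d k<d)) ⟩
    coeff (oneMinusQ ^P suc k) (suc d) + coeff (oneMinusQ ^P k) d
  ≡⟨ coeff-oneMinusQ*P (oneMinusQ ^P k) (suc d) ⟩
    coeff (oneMinusQ ^P k) (suc d)
  ≡⟨ oneMinusQ^P-degree k (suc d) (ℕP.m<n⇒m<1+n k<d) ⟩
    0ℤ
  ∎

-- The binomial identity  Σ_k C(s-j,k-j) q^(s-k) (1-q)^k = (1-q)^j

bernstein : ℕ → ℕ → Poly
bernstein s k = (varQ ^P (s ∸ k)) *P (oneMinusQ ^P k)

private
  e : ℕ → ℕ → ℤ
  e k = coeff (oneMinusQ ^P k)

  BinomialAt : ℕ → ℕ → Set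
  BinomialAt s j = ∀ d → Σ[ k < suc s ] binomShift s k j * (q^ (s ∸ k) · e k) d ≡ e j d

q^-oneMinusQ^P-suc : ∀ a k d → (q^ a · e (suc k)) d + (q· (q^ a · e k)) d ≡ (q^ a · e k) d
q^-oneMinusQ^P-suc a k d = trans (cong ((q^ a · e (suc k)) d +_) (≡.sym (q^-q· a (e k) d)))
  (q^-+ a (coeff-oneMinusQ*P (oneMinusQ ^P k)) d)

binomShift-pascal : ∀ s k → ℤ.+ (suc s C k) ≡ ℤ.+ (s C k) + binomShift (suc s) k 1
binomShift-pascal s zero    = refl
binomShift-pascal s (suc k) = cong ℤ.+_ (trans (≡.sym (nCk+nC[k+1]≡[n+1]C[k+1] s k)) (ℕP.+-comm (s C k) _))

-- The term k = 0 vanishes, and the others are (1-q) times those of the identity for (s, j).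
binomial-suc : ∀ s j → BinomialAt s j → BinomialAt (suc s) (suc j)
binomial-suc s j binomial d = ∙-cancelʳ ((q· e j) d) lhs (e (suc j) d) (begin
    lhs + (q· e j) d
  ≡⟨ cong₂ _+_ (ℤP.+-identityˡ (Σ[ k < suc s ] β k * A k)) (≡.sym (q·-cong binomial d)) ⟩
    Σ[ k < suc s ] β k * A k + (q· (λ x → Σ[ k < suc s ] β k * (q^ (s ∸ k) · e k) x)) d
  ≡⟨ cong (Σ[ k < suc s ] β k * A k +_) (≡.sym (Σ-q· (suc s) β (λ k → q^ (s ∸ k) · e k) d)) ⟩
    Σ[ k < suc s ] β k * A k + Σ[ k < suc s ] β k * B k
  ≡⟨ ≡.sym (Σ-+ (suc s) (λ k → β k * A k) (λ k → β k * B k)) ⟩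
    Σ[ k < suc s ] (β k * A k + β k * B k)
  ≡⟨ Σ-cong (suc s) (λ k _ → trans (≡.sym (ℤP.*-distribˡ-+ (β k) (A k) (B k)))
                                   (cong (β k *_) (q^-oneMinusQ^P-suc (s ∸ k) k d))) ⟩
    Σ[ k < suc s ] β k * (q^ (s ∸ k) · e k) d
  ≡⟨ binomial d ⟩
    e j d
  ≡⟨ ≡.sym (coeff-oneMinusQ*P (oneMinusQ ^P j) d) ⟩
    e (suc j) d + (q· e j) d
  ∎)
  where
    lhs : ℤ
    lhs = Σ[ k < suc (suc s) ] binomShift (suc s) k (suc j) * (q^ (suc s ∸ k) · e k) d
    β A B : ℕ → ℤ
    β k = binomShift s k j
    A k = (q^ (s ∸ k) · e (suc k)) d
    B k = (q· (q^ (s ∸ k) · e k)) d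

-- For j = 0, Pascal's rule splits the sum into q times the identity for (s, 0)
-- plus the identity for (s + 1, 1).
binomial : ∀ s j → j ≤ s → BinomialAt s j
binomial zero    zero    _         d = trans (ℤP.+-identityʳ _) (ℤP.*-identityˡ _)
binomial (suc s) (suc j) (s≤s j≤s) = binomial-suc s j (binomial s j j≤s)
binomial (suc s) zero    _         d = begin
    Σ[ k < suc (suc s) ] ℤ.+ (suc s C k) * T k
  ≡⟨ Σ-cong (suc (suc s)) (λ k _ → trans (cong (_* T k) (binomShift-pascal s k))
                                         (ℤP.*-distribʳ-+ (T k) (ℤ.+ (s C k)) (binomShift (suc s) k 1))) ⟩
    Σ[ k < suc (suc s) ] (ℤ.+ (s C k) * T k + binomShift (suc s) k 1 * T k)
  ≡⟨ Σ-+ (suc (suc s)) (λ k → ℤ.+ (s C k) * T k) (λ k → binomShift (suc s) k 1 * T k) ⟩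
    Σ[ k < suc (suc s) ] ℤ.+ (s C k) * T k + Σ[ k < suc (suc s) ] binomShift (suc s) k 1 * T k
  ≡⟨ cong₂ _+_ lower (binomial-suc s 0 (binomial s 0 z≤n) d) ⟩
    (q· e 0) d + e 1 d
  ≡⟨ ℤP.+-comm ((q· e 0) d) (e 1 d) ⟩
    e 1 d + (q· e 0) d
  ≡⟨ coeff-oneMinusQ*P (oneMinusQ ^P 0) d ⟩
    e 0 d
  ∎
  where
    T : ℕ → ℤ
    T k = (q^ (suc s ∸ k) · e k) d
    lower : Σ[ k < suc (suc s) ] ℤ.+ (s C k) * T k ≡ (q· e 0) d
    lower = begin
        Σ[ k < suc (suc s) ] ℤ.+ (s C k) * T k
      ≡⟨ Σ-last (suc s) (λ k → ℤ.+ (s C k) * T k) ⟩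
        Σ[ k < suc s ] ℤ.+ (s C k) * T k + ℤ.+ (s C suc s) * T (suc s)
      ≡⟨ cong (λ z → Σ[ k < suc s ] ℤ.+ (s C k) * T k + ℤ.+ z * T (suc s)) (k>n⇒nCk≡0 (ℕP.n<1+n s)) ⟩
        Σ[ k < suc s ] ℤ.+ (s C k) * T k + 0ℤ
      ≡⟨ ℤP.+-identityʳ _ ⟩
        Σ[ k < suc s ] ℤ.+ (s C k) * T k
      ≡⟨ Σ-cong (suc s) (λ k k<1+s → cong (λ a → ℤ.+ (s C k) * (q^ a · e k) d)
                                          (ℕP.+-∸-assoc 1 (ℕP.≤-pred k<1+s))) ⟩
        Σ[ k < suc s ] ℤ.+ (s C k) * (q· (q^ (s ∸ k) · e k)) d
      ≡⟨ Σ-q· (suc s) (λ k → ℤ.+ (s C k)) (λ k → q^ (s ∸ k) · e k) d ⟩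
        (q· (λ x → Σ[ k < suc s ] ℤ.+ (s C k) * (q^ (s ∸ k) · e k) x)) d
      ≡⟨ q·-cong (binomial s 0 z≤n) d ⟩
        (q· e 0) d
      ∎

Σ-binomShift-bernstein : ∀ s j → j ≤ s → ∀ d →
  Σ[ k < suc s ] binomShift s k j * coeff (bernstein s k) d ≡ coeff (oneMinusQ ^P j) d
Σ-binomShift-bernstein s j j≤s d = trans
  (Σ-cong (suc s) (λ k _ → cong (binomShift s k j *_) (coeff-varQ^P*P (s ∸ k) (oneMinusQ ^P k) d)))
  (binomial s j j≤s d)

module _ (s ℓ k : ℕ) where

  alphaF-suc : ∀ f i → alphaF (suc f) s ℓ k i
    ≡ binomShift s k i - Σ[ t < ℓ ∸ i ] alphaF f s ℓ k (suc i ℕ.+ t) * binomShift s (suc i ℕ.+ t) i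
  alphaF-suc f i = cong (binomShift s k i -_) (sumℤ-applyUpTo (ℓ ∸ i) _ (suc i ℕ.+_))

  alphaF-saturated : ∀ f i → ℓ ∸ i ≡ 0 → alphaF f s ℓ k i ≡ binomShift s k i
  alphaF-saturated zero    i _     = refl
  alphaF-saturated (suc f) i ℓ∸i≡0 = begin
      alphaF (suc f) s ℓ k i
    ≡⟨ alphaF-suc f i ⟩
      binomShift s k i - Σ[ t < ℓ ∸ i ] alphaF f s ℓ k (suc i ℕ.+ t) * binomShift s (suc i ℕ.+ t) i
    ≡⟨ cong (λ n → binomShift s k i - Σ[ t < n ] alphaF f s ℓ k (suc i ℕ.+ t) * binomShift s (suc i ℕ.+ t) i)
            ℓ∸i≡0 ⟩
      binomShift s k i - 0ℤ
    ≡⟨ ℤP.+-identityʳ _ ⟩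
      binomShift s k i
    ∎

  fuel-shrinks : ∀ {f} i t → ℓ ∸ i ≤ suc f → ℓ ∸ (suc i ℕ.+ t) ≤ f
  fuel-shrinks {f} i t ℓ∸i≤1+f = ℕP.≤-trans (ℕP.∸-monoʳ-≤ ℓ (ℕP.m≤m+n (suc i) t))
    (subst (_≤ f) (ℕP.pred[m∸n]≡m∸[1+n] ℓ i) (ℕP.pred-mono-≤ ℓ∸i≤1+f))

  -- Needed because alpha evaluates the indices j > i with fuel ℓ ∸ i ∸ 1 instead of ℓ ∸ j.
  alphaF-fuel : ∀ f g i → ℓ ∸ i ≤ f → ℓ ∸ i ≤ g → alphaF f s ℓ k i ≡ alphaF g s ℓ k i
  alphaF-fuel (suc f) (suc g) i p q = begin
      alphaF (suc f) s ℓ k i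
    ≡⟨ alphaF-suc f i ⟩
      binomShift s k i - Σ[ t < ℓ ∸ i ] alphaF f s ℓ k (suc i ℕ.+ t) * binomShift s (suc i ℕ.+ t) i
    ≡⟨ cong (binomShift s k i -_) (Σ-cong (ℓ ∸ i) (λ t _ → cong (_* binomShift s (suc i ℕ.+ t) i)
         (alphaF-fuel f g (suc i ℕ.+ t) (fuel-shrinks i t p) (fuel-shrinks i t q)))) ⟩
      binomShift s k i - Σ[ t < ℓ ∸ i ] alphaF g s ℓ k (suc i ℕ.+ t) * binomShift s (suc i ℕ.+ t) i
    ≡⟨ ≡.sym (alphaF-suc g i) ⟩
      alphaF (suc g) s ℓ k i
    ∎
  alphaF-fuel zero g i p _ = ≡.sym (alphaF-saturated g i (ℕP.n≤0⇒n≡0 p))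
  alphaF-fuel f zero i _ q = alphaF-saturated f i (ℕP.n≤0⇒n≡0 q)

  alpha-recurrence : ∀ i →
    alpha s ℓ k i + Σ[ t < ℓ ∸ i ] alpha s ℓ k (suc i ℕ.+ t) * binomShift s (suc i ℕ.+ t) i ≡ binomShift s k i
  alpha-recurrence i = begin
      alpha s ℓ k i + Σ[ t < ℓ ∸ i ] alpha s ℓ k (suc i ℕ.+ t) * β t
    ≡⟨ cong₂ _+_ (alphaF-fuel (ℓ ∸ i) (suc (ℓ ∸ i)) i ℕP.≤-refl (ℕP.n≤1+n _))
                 (Σ-cong (ℓ ∸ i) (λ t _ → cong (_* β t) (alphaF-fuel _ _ (suc i ℕ.+ t) ℕP.≤-refl
                   (ℕP.∸-monoʳ-≤ ℓ (ℕP.≤-trans (ℕP.n≤1+n i) (ℕP.m≤m+n (suc i) t)))))) ⟩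
      alphaF (suc (ℓ ∸ i)) s ℓ k i + S
    ≡⟨ cong (_+ S) (alphaF-suc (ℓ ∸ i) i) ⟩
      (binomShift s k i - S) + S
    ≡⟨ minus-plus (binomShift s k i) S ⟩
      binomShift s k i
    ∎
    where
      β : ℕ → ℤ
      β t = binomShift s (suc i ℕ.+ t) i
      S : ℤ
      S = Σ[ t < ℓ ∸ i ] alphaF (ℓ ∸ i) s ℓ k (suc i ℕ.+ t) * β t
      minus-plus : ∀ x y → (x - y) + y ≡ x
      minus-plus = solve-∀

-- Unitriangular systems

m<o∸n⇒1+n+m≤o : ∀ {m n o} → n ≤ o → m < o ∸ n → suc n ℕ.+ m ≤ o
m<o∸n⇒1+n+m≤o {m} {n} {o} n≤o m<o∸n =
  subst (_≤ o) (cong suc (ℕP.+-comm m n)) (ℕP.m≤o∸n⇒m+n≤o (suc m) n≤o m<o∸n)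

downward-induction : ∀ {p} (P : ℕ → Set p) ℓ →
  (∀ j → j ≤ ℓ → (∀ j′ → j < j′ → j′ ≤ ℓ → P j′) → P j) →
  ∀ j → j ≤ ℓ → P j
downward-induction P ℓ descend j = go ℓ j (ℕP.m≤m+n ℓ j)
  where
    go : ∀ gap j → ℓ ≤ gap ℕ.+ j → j ≤ ℓ → P j
    go zero      j ℓ≤j       j≤ℓ = descend j j≤ℓ (λ j′ j<j′ j′≤ℓ →
      contradiction (ℕP.<-≤-trans j<j′ (ℕP.≤-trans j′≤ℓ ℓ≤j)) (ℕP.n≮n j))
    go (suc gap) j ℓ≤1+gap+j j≤ℓ = descend j j≤ℓ (λ j′ j<j′ j′≤ℓ →
      go gap j′ (ℕP.≤-trans ℓ≤1+gap+j (subst (_≤ gap ℕ.+ j′) (ℕP.+-suc gap j) (ℕP.+-monoʳ-≤ gap j<j′))) j′≤ℓ)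

unitriangular-zero : ∀ (X : ℕ → ℤ) (b : ℕ → ℕ → ℤ) m ℓ →
  (∀ j → m ≤ j → j ≤ ℓ → X j + Σ[ t < ℓ ∸ j ] b j t * X (suc j ℕ.+ t) ≡ 0ℤ) →
  ∀ j → m ≤ j → j ≤ ℓ → X j ≡ 0ℤ
unitriangular-zero X b m ℓ system j m≤j j≤ℓ =
  downward-induction (λ j → m ≤ j → X j ≡ 0ℤ) ℓ descend j j≤ℓ m≤j
  where
    descend : ∀ j → j ≤ ℓ → (∀ j′ → j < j′ → j′ ≤ ℓ → m ≤ j′ → X j′ ≡ 0ℤ) → m ≤ j → X j ≡ 0ℤ
    descend j j≤ℓ above m≤j = begin
        X j
      ≡⟨ ≡.sym (ℤP.+-identityʳ (X j)) ⟩
        X j + 0ℤ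
      ≡⟨ cong (X j +_) (≡.sym (Σ-zero (ℓ ∸ j) above-zero)) ⟩
        X j + Σ[ t < ℓ ∸ j ] b j t * X (suc j ℕ.+ t)
      ≡⟨ system j m≤j j≤ℓ ⟩
        0ℤ
      ∎
      where
        above-zero : ∀ t → t < ℓ ∸ j → b j t * X (suc j ℕ.+ t) ≡ 0ℤ
        above-zero t t<ℓ∸j = trans (cong (b j t *_) (above (suc j ℕ.+ t) j<1+j+t (m<o∸n⇒1+n+m≤o j≤ℓ t<ℓ∸j)
                                                       (ℕP.≤-trans m≤j (ℕP.<⇒≤ j<1+j+t))))
                                   (ℤP.*-zeroʳ (b j t))
          where
            j<1+j+t : j < suc j ℕ.+ t
            j<1+j+t = s≤s (ℕP.m≤m+n j t)

∣p─q∣+∣q∣≡∣p∣ : ∀ {n} (p q : Subset n) → q ⊆ p → ∣ p ─ q ∣ ℕ.+ ∣ q ∣ ≡ ∣ p ∣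
∣p─q∣+∣q∣≡∣p∣ []            []            _   = refl
∣p─q∣+∣q∣≡∣p∣ (outside ∷ p) (outside ∷ q) q⊆p = ∣p─q∣+∣q∣≡∣p∣ p q (drop-∷-⊆ q⊆p)
∣p─q∣+∣q∣≡∣p∣ (inside ∷ p)  (outside ∷ q) q⊆p = cong suc (∣p─q∣+∣q∣≡∣p∣ p q (drop-∷-⊆ q⊆p))
∣p─q∣+∣q∣≡∣p∣ (inside ∷ p)  (inside ∷ q)  q⊆p =
  trans (ℕP.+-suc _ _) (cong suc (∣p─q∣+∣q∣≡∣p∣ p q (drop-∷-⊆ q⊆p)))
∣p─q∣+∣q∣≡∣p∣ (outside ∷ p) (inside ∷ q)  q⊆p with q⊆p here
... | ()

∣p∣≡0⇒p≡⊥ : ∀ {n} (p : Subset n) → ∣ p ∣ ≡ 0 → p ≡ ⊥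
∣p∣≡0⇒p≡⊥ []            _     = refl
∣p∣≡0⇒p≡⊥ (outside ∷ p) ∣p∣≡0 = cong (outside ∷_) (∣p∣≡0⇒p≡⊥ p ∣p∣≡0)
∣p∣≡0⇒p≡⊥ (inside ∷ p)  ()

any-false : ∀ {A : Set} (p : A → Bool) xs → (∀ x → p x ≡ false) → any p xs ≡ false
any-false p []       _       = refl
any-false p (x ∷ xs) p≡false rewrite p≡false x = any-false p xs p≡false

findᵇ-none : ∀ {A : Set} (p : A → Bool) xs → (∀ x → p x ≡ false) → findᵇ p xs ≡ nothing
findᵇ-none p []       _       = refl
findᵇ-none p (x ∷ xs) p≡false rewrite p≡false x = findᵇ-none p xs p≡false

iter-fixed : ∀ {A : Set} k (f : A → A) {a} → f a ≡ a → iter k f a ≡ a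
iter-fixed zero    f _    = refl
iter-fixed (suc k) f fa≡a = trans (cong (iter k f) fa≡a) (iter-fixed k f fa≡a)

NS-⊥ : ∀ {n} (G : Graph n) → NS[ G ∣ ⊥ ] ≡ ⊥
NS-⊥ {n} G = trans (tabulate-cong (λ y → trans
    (any-false _ (allFin n) (λ x → cong (_∧ lookup N[ G ∣ x ] y) (lookup-replicate x outside)))
    (≡.sym (lookup-replicate y outside))))
  (tabulate∘lookup ⊥)

forces-⊥ : ∀ {n} (G : Graph n) x → forces G ⊥ x ≡ false
forces-⊥ G x = cong (_∧ (∣ N[ G ∣ x ] ─ ⊥ ∣ ℕ.≡ᵇ 1)) (lookup-replicate x outside)

step-⊥ : ∀ {n} (G : Graph n) → step G ⊥ ≡ ⊥
step-⊥ {n} G rewrite findᵇ-none (forces G ⊥) (allFin n) (forces-⊥ G) = refl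

Obs-⊥ : ∀ {n} (G : Graph n) → Obs G ⊥ ≡ ⊥
Obs-⊥ {n} G = trans (cong (iter n (step G)) (NS-⊥ G)) (iter-fixed n (step G) (step-⊥ G))

obsSum-zero : ∀ {n} (G : Graph n) S → obsSum G S 0 ≡ 0ℤ
obsSum-zero {n} G S =
  sumℤ-zero (All.map (λ {W} → size-zero W) (all-filter (λ W → ∣ W ∣ ℕ.≟ 0) (subsetsOf S)))
  where
    size-zero : ∀ W → ∣ W ∣ ≡ 0 → ℤ.+ ∣ Obs G W ∣ ≡ 0ℤ
    size-zero W ∣W∣≡0 = begin
      ℤ.+ ∣ Obs G W ∣  ≡⟨ cong (λ V → ℤ.+ ∣ Obs G V ∣) (∣p∣≡0⇒p≡⊥ W ∣W∣≡0) ⟩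
      ℤ.+ ∣ Obs G ⊥ ∣  ≡⟨ cong (λ V → ℤ.+ ∣ V ∣) (Obs-⊥ G) ⟩
      ℤ.+ ∣ ⊥ {n} ∣    ≡⟨ cong ℤ.+_ (∣⊥∣≡0 n) ⟩
      0ℤ               ∎

coeff-Epoly : ∀ {n} (G : Graph n) S d →
  coeff (Epoly G S) d ≡ Σ[ k < suc ∣ S ∣ ] obsSum G S k * coeff (bernstein ∣ S ∣ k) d
coeff-Epoly {n} G S d = begin
    coeff (Epoly G S) d
  ≡⟨ coeff-foldr-+P _ (subsetsOf S) d ⟩
    sumℤ (map (λ W → coeff (term W) d) (subsetsOf S))
  ≡⟨ cong sumℤ (map-cong-local (All.map coeff-term subsetsOf⊆S)) ⟩
    sumℤ (map (λ W → ℤ.+ ∣ Obs G W ∣ * coeff (bernstein ∣ S ∣ ∣ W ∣) d) (subsetsOf S))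
  ≡⟨ sumℤ-groupBy (suc ∣ S ∣) ∣_∣ (λ W → ℤ.+ ∣ Obs G W ∣) (λ k → coeff (bernstein ∣ S ∣ k) d) (subsetsOf S)
       (All.map size-bound subsetsOf⊆S) ⟩
    Σ[ k < suc ∣ S ∣ ] obsSum G S k * coeff (bernstein ∣ S ∣ k) d
  ∎
  where
    weight term : Subset n → Poly
    weight W = (varQ ^P ∣ S ─ W ∣) *P (oneMinusQ ^P ∣ W ∣)
    term W = scaleP (ℤ.+ ∣ Obs G W ∣) (weight W)
    subsetsOf⊆S : All (_⊆ S) (subsetsOf S)
    subsetsOf⊆S = all-filter (_⊆? S) (allSubsets n)
    size-bound : ∀ {W} → W ⊆ S → ∣ W ∣ < suc ∣ S ∣
    size-bound W⊆S = s≤s (p⊆q⇒∣p∣≤∣q∣ W⊆S)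
    coeff-term : ∀ {W} → W ⊆ S → coeff (term W) d ≡ ℤ.+ ∣ Obs G W ∣ * coeff (bernstein ∣ S ∣ ∣ W ∣) d
    coeff-term {W} W⊆S = trans (coeff-scaleP (ℤ.+ ∣ Obs G W ∣) (weight W) d)
      (cong (λ a → ℤ.+ ∣ Obs G W ∣ * coeff ((varQ ^P a) *P (oneMinusQ ^P ∣ W ∣)) d)
        (trans (≡.sym (ℕP.m+n∸n≡m ∣ S ─ W ∣ ∣ W ∣)) (cong (_∸ ∣ W ∣) (∣p─q∣+∣q∣≡∣p∣ S W W⊆S))))

alpha-bernstein-vanish : ∀ s ℓ d → ℓ ≤ s → ℓ < d → ∀ j → 1 ≤ j → j ≤ ℓ →
  Σ[ k < s ] alpha s ℓ (suc k) j * coeff (bernstein s (suc k)) d ≡ 0ℤ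
alpha-bernstein-vanish s ℓ d ℓ≤s ℓ<d =
  unitriangular-zero X (λ j t → binomShift s (suc j ℕ.+ t) j) 1 ℓ system
  where
    c : ℕ → ℤ
    c k = coeff (bernstein s k) d
    X : ℕ → ℤ
    X j = Σ[ k < s ] alpha s ℓ (suc k) j * c (suc k)
    system : ∀ j → 1 ≤ j → j ≤ ℓ → X j + Σ[ t < ℓ ∸ j ] binomShift s (suc j ℕ.+ t) j * X (suc j ℕ.+ t) ≡ 0ℤ
    system (suc i) _ j≤ℓ = begin
        X j + Σ[ t < ℓ ∸ j ] β t * X (suc j ℕ.+ t)
      ≡⟨ cong (X j +_) (≡.sym (Σ-exchange s (ℓ ∸ j) A β (λ k → c (suc k)))) ⟩
        X j + Σ[ k < s ] R k * c (suc k)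
      ≡⟨ ≡.sym (Σ-+ s (λ k → alpha s ℓ (suc k) j * c (suc k)) (λ k → R k * c (suc k))) ⟩
        Σ[ k < s ] (alpha s ℓ (suc k) j * c (suc k) + R k * c (suc k))
      ≡⟨ Σ-cong s (λ k _ → ≡.sym (ℤP.*-distribʳ-+ (c (suc k)) (alpha s ℓ (suc k) j) (R k))) ⟩
        Σ[ k < s ] (alpha s ℓ (suc k) j + R k) * c (suc k)
      ≡⟨ Σ-cong s (λ k _ → cong (_* c (suc k)) (alpha-recurrence s ℓ (suc k) j)) ⟩
        Σ[ k < s ] binomShift s (suc k) j * c (suc k)
      ≡⟨ ≡.sym (ℤP.+-identityˡ (Σ[ k < s ] binomShift s (suc k) j * c (suc k))) ⟩
        -- the k = 0 term is 0, as j ≥ 1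
        Σ[ k < suc s ] binomShift s k j * c k
      ≡⟨ Σ-binomShift-bernstein s j (ℕP.≤-trans j≤ℓ ℓ≤s) d ⟩
        coeff (oneMinusQ ^P j) d
      ≡⟨ oneMinusQ^P-degree j d (ℕP.≤-<-trans j≤ℓ ℓ<d) ⟩
        0ℤ
      ∎
      where
        j : ℕ
        j = suc i
        β : ℕ → ℤ
        β t = binomShift s (suc j ℕ.+ t) j
        A : ℕ → ℕ → ℤ
        A k t = alpha s ℓ (suc k) (suc j ℕ.+ t)
        R : ℕ → ℤ
        R k = Σ[ t < ℓ ∸ j ] A k t * β t

theorem3p6 : (n : ℕ) (G : Graph n) (S : Subset n) (ℓ : ℕ) → ℓ ≤ ∣ S ∣
    → ((k : ℕ) → 1 ≤ k → k ≤ ∣ S ∣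
        → obsSum G S k ≡ sumℤ (map (λ i → alpha ∣ S ∣ ℓ k i * obsSum G S i) (range 1 ℓ)))
    → DegreeAtMost (Epoly G S) ℓ
theorem3p6 n G S ℓ ℓ≤s hyp d ℓ<d = begin
    coeff (Epoly G S) d
  ≡⟨ coeff-Epoly G S d ⟩
    a 0 * c 0 + Σ[ k < s ] a (suc k) * c (suc k)
  ≡⟨ cong (λ z → z * c 0 + Σ[ k < s ] a (suc k) * c (suc k)) (obsSum-zero G S) ⟩
    0ℤ + Σ[ k < s ] a (suc k) * c (suc k)
  ≡⟨ ℤP.+-identityˡ _ ⟩
    Σ[ k < s ] a (suc k) * c (suc k)
  ≡⟨ Σ-cong s (λ k k<s → cong (_* c (suc k)) (trans (hyp (suc k) (s≤s z≤n) k<s) (sumℤ-applyUpTo ℓ _ _))) ⟩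
    Σ[ k < s ] (Σ[ t < ℓ ] alpha s ℓ (suc k) (suc t) * a (suc t)) * c (suc k)
  ≡⟨ Σ-exchange s ℓ (λ k t → alpha s ℓ (suc k) (suc t)) (λ t → a (suc t)) (λ k → c (suc k)) ⟩
    Σ[ t < ℓ ] a (suc t) * (Σ[ k < s ] alpha s ℓ (suc k) (suc t) * c (suc k))
  ≡⟨ Σ-zero ℓ (λ t t<ℓ → trans (cong (a (suc t) *_) (alpha-bernstein-vanish s ℓ d ℓ≤s ℓ<d (suc t) (s≤s z≤n) t<ℓ))
                               (ℤP.*-zeroʳ (a (suc t)))) ⟩
    0ℤ
  ∎
  where
    s : ℕ
    s = ∣ S ∣
    a c : ℕ → ℤ
    a = obsSum G S
    c k = coeff (bernstein s k) d
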